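{- Let $X$ be a poset. (i) If $(L, \preceq, \gamma)$ is a weak adequate domain of limits on $X$, then $\gamma$ is an order-isomorphism from $(L \cup X, \preceq)$ onto its image $\gamma(L \cup X)$, i.e. a map onto $\gamma(L\cup X)$ that preserves and reflects the order: $z \preceq z'$ iff $\gamma(z) \subseteq \gamma(z')$. Here $\gamma(L\cup X)$ is ordered by inclusion, $\gamma(L\cup X) \subseteq \mathcal{H}(X_a)$, and $\mathcal{S}(X_a) \subseteq \gamma(L \cup X)$. (ii) Conversely, assume $X$ is well-quasi-ordered, and let $Y$ be any subset of $\mathcal{H}(X_a)$ with $\mathcal{S}(X_a) \subseteq Y$. Let $$L = Y \setminus \{{\downarrow} x \mid x \in X\}.$$ Let $\gamma$ map each $x \in X$ to ${\downarrow}_X x$ and each $F \in L$ to $F$ itself. Let $\preceq$ be the relation on $L \cup X$ defined by $z \preceq z'$ iff $\gamma(z) \subseteq \gamma(z')$. Then $(L, \preceq, \gamma)$ is a weak adequate domain of limits on $X$.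
   Context: For a poset $(X,\le)$ and $E \subseteq X$, write ${\downarrow} E = \{y \in X \mid \exists x \in E,\ y \le x\}$ and ${\downarrow} x = {\downarrow}\{x\}$. A subset $D$ is downward closed if $D = {\downarrow} D$. $X_a$ denotes $X$ with its Alexandroff topology, whose open sets are the upward closed subsets. Its closed sets are therefore exactly the downward closed subsets of $X$. $\mathcal{H}(X_a)$ is the set of all closed subsets of $X_a$, i.e. all downward closed subsets of $X$, including $\emptyset$, ordered by inclusion. A closed subset $F$ of $X_a$ is irreducible if $F \neq \emptyset$ and, whenever $F \subseteq F_1 \cup F_2$ with $F_1, F_2$ closed, then $F \subseteq F_1$ or $F \subseteq F_2$. $\mathcal{S}(X_a)$ (the sobrification of $X_a$) is the set of irreducible closed subsets of $X_a$, ordered by inclusion. Each ${\downarrow} x$ with $x \in X$ belongs to $\mathcal{S}(X_a)$. A quasi-ordering is a well quasi-ordering (wqo) if it is well-founded and has no infinite antichain. A weak adequate domain of limits (WADL) on $X$ is a triple $(L, \preceq, \gamma)$ satisfying the following. - $L$ is a set disjoint from $X$, $\preceq$ is a binary relation on $L \cup X$, and $\gamma : L \cup X \to \mathcal{P}(X)$. - $(\mathrm{L}_1)$: $\gamma(z)$ is downward closed for every $z \in L \cup X$, and $\gamma(x) = {\downarrow}_X x$ for every $x \in X$. - $(\mathrm{L}_3)$: $z \preceq z'$ iff $\gamma(z) \subseteq \gamma(z')$. - $(\mathrm{L}_4)$: for every downward closed $D \subseteq X$ there is a finite $E \subseteq L \cup X$ with $\bigcup_{z \in E} \gamma(z) =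 D$. In (ii), the elements of $L$ (subsets of $X$) are tacitly assumed distinct from the elements of $X$, e.g. by tagging. -}

module Defs where

open import Level using (Level; _⊔_) renaming (suc to lsuc; zero to lzero)
open import Data.Nat using (ℕ)
open import Data.Empty using (⊥)
open import Data.Product using (Σ; _×_; _,_)
open import Data.Sum using (_⊎_; inj₁; inj₂)
open import Data.List using (List; []; _∷_)
open import Relation.Nullary using (¬_; Dec)
open import Relation.Binary.PropositionalEquality using (_≡_)
open import Induction.WellFounded using (WellFounded)
open import Function.Bundles using (_⇔_)

Subset : Set → Set₁
Subset X = X → Set

module _ {X : Set} where

  _⊆_ : Subset X → Subset X → Set
  A ⊆ B = ∀ x → A x → B x

  _≐_ : Subset X → Subset X → Set
  A ≐ B = (A ⊆ B) × (B ⊆ A)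

  ∅ : Subset X
  ∅ _ = ⊥

  _∪_ : Subset X → Subset X → Subset X
  (A ∪ B) x = A x ⊎ B x

module Order {X : Set} (_≤_ : X → X → Set) where

  ↓ : Subset X → Subset X
  ↓ E y = Σ X λ x → E x × (y ≤ x)

  ↓pt : X → Subset X
  ↓pt x = ↓ (λ y → y ≡ x)

  -- D downward closed iff D = ↓ D; these are exactly the closed sets of X_a,
  -- i.e. the elements of H(X_a)
  DownClosed : Subset X → Set
  DownClosed D = D ≐ ↓ D

  -- irreducible closed subsets of X_a, i.e. elements of S(X_a)
  Irreducible : Subset X → Set₁
  Irreducible F =
    DownClosed F ×
    (¬ (F ≐ ∅)) ×
    (∀ (F₁ F₂ : Subset X) → DownClosed F₁ → DownClosed F₂ →
       F ⊆ (F₁ ∪ F₂) → (F ⊆ F₁) ⊎ (F ⊆ F₂))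

  _<_ : X → X → Set
  x < y = (x ≤ y) × ¬ (x ≡ y)

  IsWQO : Set
  IsWQO =
    WellFounded _<_ ×
    (¬ (Σ (ℕ → X) λ f → ∀ (i j : ℕ) → ¬ (i ≡ j) → ¬ (f i ≤ f j)))

  -- union of γ(z) over a finite E ⊆ L ∪ X (E given as a list)
  ⋃ : {a : Level} {L : Set a} → (L ⊎ X → Subset X) → List (L ⊎ X) → Subset X
  ⋃ γ []       x = ⊥
  ⋃ γ (z ∷ E) x = γ z x ⊎ ⋃ γ E x

  -- weak adequate domain of limits; L ∪ X is the disjoint sum L ⊎ X
  record IsWADL {a b : Level} (L : Set a) (_≼_ : L ⊎ X → L ⊎ X → Set b)
                (γ : L ⊎ X → Subset X) : Set (lsuc lzero ⊔ a ⊔ b) where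
    field
      L1-closed : ∀ z → DownClosed (γ z)
      L1-point  : ∀ x → γ (inj₂ x) ≐ ↓pt x
      L3        : ∀ z z′ → (z ≼ z′) ⇔ (γ z ⊆ γ z′)
      L4        : ∀ (D : Subset X) → DownClosed D →
                  Σ (List (L ⊎ X)) λ E → ⋃ γ E ≐ D

  module Construction (Y : Subset X → Set₁) where

    Lᵧ : Set₁
    Lᵧ = Σ (Subset X) λ F → Y F × ¬ (Σ X λ x → F ≐ ↓pt x)

    γᵧ : Lᵧ ⊎ X → Subset X
    γᵧ (inj₁ (F , _)) = F
    γᵧ (inj₂ x) = ↓pt x

    _≼ᵧ_ : Lᵧ ⊎ X → Lᵧ ⊎ X → Set
    z ≼ᵧ z′ = γᵧ z ⊆ γᵧ z′

-- classical logic (excluded middle), the paper's ambient logic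
ExcludedMiddle : Set₂
ExcludedMiddle = (P : Set₁) → Dec P

module Submission where

-- (i) is almost definitional: (L3) and (L1) are the first two claims.  For
-- the third, an irreducible closed F is by (L4) a finite union of sets
-- γ(z); irreducibility makes F "prime" for finite unions of closed sets,
-- so F ⊆ γ(z) for one member z, and then γ(z) = F.
--
-- (ii) reduces to (L4): on a wqo every downward closed set D is a finite
-- union of irreducible closed sets, each of which is some γ(z).  Classically,
-- if D is not such a finite union it is reducible, and one of its two pieces
-- D ∩ Fᵢ is again not a finite union but misses a point of D.  Iterating
-- (dependent choice) gives a decreasing chain D₀ ⊋ D₁ ⊋ … and points
-- xₙ ∈ Dₙ \ Dₙ₊₁ forming a bad sequence (i < j ⇒ xᵢ ≰ xⱼ), which a wqo
-- does not admit.

open import Defs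
open import Level using (Level; Lift; lift)
open import Data.Product using (Σ; _×_; _,_; proj₁; proj₂)
open import Data.Sum using (_⊎_; inj₁; inj₂; [_,_])
open import Data.List using (List; []; _∷_; _++_)
open import Data.List.Membership.Propositional using (_∈_)
open import Data.List.Relation.Unary.Any using (here; there)
open import Data.Nat using (ℕ; zero; suc; z≤n) renaming (_<_ to _<ℕ_; _≤_ to _≤ℕ_)
open import Data.Nat.Properties using (m≤n⇒m<n∨m≡n; <-cmp; <⇒≤; ≤-pred; <-≤-trans; ≤-trans) renaming (≤-refl to ≤ℕ-refl)
open import Data.Empty using (⊥; ⊥-elim)
open import Relation.Nullary using (¬_; Dec; yes; no)
open import Relation.Nullary.Decidable using (decidable-stable)
open import Relation.Binary.Definitions using (Reflexive; Transitive; tri<; tri≈; tri>)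
open import Relation.Binary.PropositionalEquality using (_≡_; refl; sym)
open import Relation.Binary.Structures using (IsPartialOrder)
open import Function.Bundles using (_⇔_; mk⇔)
open import Induction.WellFounded using (WellFounded)
open import Induction.InfiniteDescent using (InfiniteDescendingSequence; descent∧wf⇒empty)

module Sequences {a} {A : Set a} where

  dependent-choice : ∀ {p r} (P : A → Set p) (R : A → A → Set r) →
    Σ A P → (∀ {x} → P x → Σ A λ y → P y × R x y) →
    Σ (ℕ → A) λ s → (∀ n → P (s n)) × (∀ n → R (s n) (s (suc n)))
  dependent-choice P R seed step =
    (λ n → proj₁ (walk n)) , (λ n → proj₂ (walk n)) , (λ n → proj₂ (proj₂ (step (proj₂ (walk n)))))
    where
    walk : ℕ → Σ A P
    walk zero    = seed
    walk (suc n) = proj₁ next , proj₁ (proj₂ next)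
      where next = step (proj₂ (walk n))

  chain-≤ : ∀ {q} (Q : A → A → Set q) → Reflexive Q → Transitive Q →
    (s : ℕ → A) → (∀ n → Q (s n) (s (suc n))) → ∀ {i j} → i ≤ℕ j → Q (s i) (s j)
  chain-≤ Q reflQ transQ s step {j = zero} z≤n = reflQ
  chain-≤ Q reflQ transQ s step {j = suc j} i≤1+j with m≤n⇒m<n∨m≡n i≤1+j
  ... | inj₁ i<1+j = transQ (chain-≤ Q reflQ transQ s step (≤-pred i<1+j)) (step j)
  ... | inj₂ refl  = reflQ

  wf⇒no-descent : ∀ {r} {R : A → A → Set r} → WellFounded R →
    (s : ℕ → A) → ¬ InfiniteDescendingSequence R s
  wf⇒no-descent {R = R} wf s desc = descent∧wf⇒empty descent wf (s 0) (s , refl , desc)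
    where
    DescendsFrom : A → Set _
    DescendsFrom x = Σ (ℕ → A) λ t → t 0 ≡ x × InfiniteDescendingSequence R t
    descent : ∀ {x} → DescendsFrom x → Σ A λ y → R y x × DescendsFrom y
    descent (t , refl , d) = t 1 , d 0 , (λ n → t (suc n)) , refl , (λ n → d (suc n))

strictly-increasing : (g : ℕ → ℕ) → (∀ n → g n <ℕ g (suc n)) → ∀ {i j} → i <ℕ j → g i <ℕ g j
strictly-increasing g step {i} i<j =
  <-≤-trans (step i) (Sequences.chain-≤ _≤ℕ_ ≤ℕ-refl ≤-trans g (λ n → <⇒≤ (step n)) i<j)

module Classical (em : ExcludedMiddle) where

  decide : (P : Set) → Dec P
  decide P with em (Lift _ P)
  ... | yes (lift p) = yes p
  ... | no ¬p        = no (λ p → ¬p (lift p))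

  ¬¬-elim : {P : Set} → ¬ ¬ P → P
  ¬¬-elim = decidable-stable (decide _)

  ¬∀⇒∃¬ : {A : Set} {P : A → Set} → ¬ (∀ x → P x) → Σ A λ x → ¬ P x
  ¬∀⇒∃¬ ¬∀ = ¬¬-elim (λ ¬∃ → ¬∀ (λ x → ¬¬-elim (λ ¬Px → ¬∃ (x , ¬Px))))

  ¬→⇒×¬ : {P Q : Set} → ¬ (P → Q) → P × ¬ Q
  ¬→⇒×¬ ¬imp = ¬¬-elim (λ ¬p → ¬imp (λ p → ⊥-elim (¬p p))) , (λ q → ¬imp (λ _ → q))

  ⊈-witness : {X : Set} {A B : Subset X} → ¬ (A ⊆ B) → Σ X λ x → A x × ¬ B x
  ⊈-witness ¬A⊆B with ¬∀⇒∃¬ ¬A⊆B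
  ... | x , ¬[Ax→Bx] = x , ¬→⇒×¬ ¬[Ax→Bx]

module Poset (X : Set) (_≤_ : X → X → Set) (isPO : IsPartialOrder _≡_ _≤_) where
  open Order _≤_
  open IsPartialOrder isPO using (reflexive) renaming (refl to ≤-refl′; trans to ≤-trans′)

  -- Downward closedness without ↓: D ⊆ ↓ D always holds by reflexivity, so
  -- D is closed iff it is a lower set.
  LowerSet : Subset X → Set
  LowerSet D = ∀ {x y} → x ≤ y → D y → D x

  lower-set⇒closed : ∀ {D} → LowerSet D → DownClosed D
  lower-set⇒closed low = (λ x d → x , d , ≤-refl′) , (λ x (y , d , x≤y) → low x≤y d)

  closed⇒lower-set : ∀ {D} → DownClosed D → LowerSet D
  closed⇒lower-set (_ , ↓D⊆D) {x} {y} x≤y d = ↓D⊆D x (y , d , x≤y)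

  ∅-closed : DownClosed ∅
  ∅-closed = lower-set⇒closed (λ _ ())

  ∪-closed : ∀ {A B} → DownClosed A → DownClosed B → DownClosed (A ∪ B)
  ∪-closed cA cB = lower-set⇒closed λ x≤y →
    [ (λ a → inj₁ (closed⇒lower-set cA x≤y a)) , (λ b → inj₂ (closed⇒lower-set cB x≤y b)) ]

  ∩-closed : ∀ {A B} → DownClosed A → DownClosed B → DownClosed (λ x → A x × B x)
  ∩-closed cA cB = lower-set⇒closed λ x≤y (a , b) →
    closed⇒lower-set cA x≤y a , closed⇒lower-set cB x≤y b

  ↓pt-closed : ∀ x → DownClosed (↓pt x)
  ↓pt-closed x = lower-set⇒closed λ u≤v (w , w≡x , v≤w) → w , w≡x , ≤-trans′ u≤v v≤w

  module FiniteUnions {ℓ} {L : Set ℓ} (γ : L ⊎ X → Subset X) where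

    ⋃-closed : (∀ z → DownClosed (γ z)) → ∀ E → DownClosed (⋃ γ E)
    ⋃-closed closed []      = ∅-closed
    ⋃-closed closed (z ∷ E) = ∪-closed (closed z) (⋃-closed closed E)

    ⋃-upper : ∀ {z E} → z ∈ E → γ z ⊆ ⋃ γ E
    ⋃-upper (here refl) x g = inj₁ g
    ⋃-upper (there z∈E) x g = inj₂ (⋃-upper z∈E x g)

    ⋃-++ : ∀ E₁ E₂ → ⋃ γ (E₁ ++ E₂) ≐ (⋃ γ E₁ ∪ ⋃ γ E₂)
    ⋃-++ []       E₂ = (λ x → inj₂) , (λ x → [ (λ ()) , (λ g → g) ])
    ⋃-++ (z ∷ E₁) E₂ = to , from
      where
      to : ⋃ γ (z ∷ E₁ ++ E₂) ⊆ (⋃ γ (z ∷ E₁) ∪ ⋃ γ E₂)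
      to x (inj₁ g) = inj₁ (inj₁ g)
      to x (inj₂ g) = [ (λ g₁ → inj₁ (inj₂ g₁)) , inj₂ ] (proj₁ (⋃-++ E₁ E₂) x g)
      from : (⋃ γ (z ∷ E₁) ∪ ⋃ γ E₂) ⊆ ⋃ γ (z ∷ E₁ ++ E₂)
      from x (inj₁ (inj₁ g)) = inj₁ g
      from x (inj₁ (inj₂ g)) = inj₂ (proj₂ (⋃-++ E₁ E₂) x (inj₁ g))
      from x (inj₂ g)        = inj₂ (proj₂ (⋃-++ E₁ E₂) x (inj₂ g))

    Generated : Subset X → Set _
    Generated D = Σ (List (L ⊎ X)) λ E → ⋃ γ E ≐ D

    generated-∅ : Generated ∅
    generated-∅ = [] , (λ _ ()) , (λ _ ())

    generated-∪ : ∀ {A B} → Generated A → Generated B → Generated (A ∪ B)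
    generated-∪ (E₁ , ⊆A , A⊆) (E₂ , ⊆B , B⊆) = E₁ ++ E₂ ,
      (λ x g → [ (λ g₁ → inj₁ (⊆A x g₁)) , (λ g₂ → inj₂ (⊆B x g₂)) ] (proj₁ (⋃-++ E₁ E₂) x g)) ,
      (λ x → [ (λ a → proj₂ (⋃-++ E₁ E₂) x (inj₁ (A⊆ x a))) , (λ b → proj₂ (⋃-++ E₁ E₂) x (inj₂ (B⊆ x b))) ])

    generated-≐ : ∀ {A B} → Generated A → A ≐ B → Generated B
    generated-≐ (E , ⊆A , A⊆) (A⊆B , B⊆A) = E , (λ x g → A⊆B x (⊆A x g)) , (λ x b → A⊆ x (B⊆A x b))

    irreducible-prime : ∀ {F} → Irreducible F → (∀ z → DownClosed (γ z)) →
      ∀ E → F ⊆ ⋃ γ E → Σ (L ⊎ X) λ z → z ∈ E × F ⊆ γ z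
    irreducible-prime (_ , nonempty , _) closed [] F⊆ = ⊥-elim (nonempty (F⊆ , λ _ ()))
    irreducible-prime {F} irr@(_ , _ , split) closed (z ∷ E) F⊆
      with split (γ z) (⋃ γ E) (closed z) (⋃-closed closed E) F⊆
    ... | inj₁ F⊆γz = z , here refl , F⊆γz
    ... | inj₂ F⊆⋃E with irreducible-prime irr closed E F⊆⋃E
    ...   | z′ , z′∈E , F⊆γz′ = z′ , there z′∈E , F⊆γz′

  wadl-covers-irreducibles : ∀ {a b} {L : Set a} {_≼_ : L ⊎ X → L ⊎ X → Set b} {γ : L ⊎ X → Subset X} →
    IsWADL L _≼_ γ → ∀ F → Irreducible F → Σ (L ⊎ X) λ z → γ z ≐ F
  wadl-covers-irreducibles {γ = γ} wadl F irr@(F-closed , _) =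
    let (E , ⋃E⊆F , F⊆⋃E) = L4 F F-closed
        (z , z∈E , F⊆γz)  = irreducible-prime irr L1-closed E F⊆⋃E
    in z , (λ x g → ⋃E⊆F x (⋃-upper z∈E x g)) , F⊆γz
    where
    open IsWADL wadl
    open FiniteUnions γ

  module WellQuasiOrdered (em : ExcludedMiddle) (wqo : IsWQO) where
    open Classical em

    Bad : (ℕ → X) → Set
    Bad f = ∀ {i j} → i <ℕ j → ¬ (f i ≤ f j)

    module _ (f : ℕ → X) (bad : Bad f) where

      Terminal : ℕ → Set
      Terminal k = ∀ j → k <ℕ j → ¬ (f j ≤ f k)

      -- Infinitely many terminal indices would form an infinite antichain.
      terminals-bounded : ¬ (∀ n → Σ ℕ λ k → n ≤ℕ k × Terminal k)
      terminals-bounded unbounded = proj₂ wqo ((λ n → f (g n)) , antichain)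
        where
        chosen : Σ (ℕ → ℕ) λ g → (∀ n → Terminal (g n)) × (∀ n → g n <ℕ g (suc n))
        chosen = Sequences.dependent-choice Terminal _<ℕ_
                   (let (k , _ , t) = unbounded 0 in k , t)
                   (λ {k} _ → let (j , k<j , t) = unbounded (suc k) in j , t , k<j)
        g : ℕ → ℕ
        g = proj₁ chosen
        g-terminal : ∀ n → Terminal (g n)
        g-terminal = proj₁ (proj₂ chosen)
        g-increasing : ∀ {i j} → i <ℕ j → g i <ℕ g j
        g-increasing = strictly-increasing g (proj₂ (proj₂ chosen))
        antichain : ∀ i j → ¬ (i ≡ j) → ¬ (f (g i) ≤ f (g j))
        antichain i j i≢j with <-cmp i j
        ... | tri< i<j _ _ = bad (g-increasing i<j)
        ... | tri≈ _ i≡j _ = ⊥-elim (i≢j i≡j)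
        ... | tri> _ _ j<i = g-terminal j (g i) (g-increasing j<i)

      -- If from N on no index is terminal, f has an infinite strictly
      -- descending subsequence, contradicting well-foundedness.
      terminals-unbounded : ¬ (Σ ℕ λ N → ∀ k → N ≤ℕ k → ¬ Terminal k)
      terminals-unbounded (N , none) =
        Sequences.wf⇒no-descent (proj₁ wqo) (λ n → f (s n)) strict-descent
        where
        Below : ℕ → ℕ → Set
        Below k j = k <ℕ j × f j ≤ f k
        below : ∀ {k} → N ≤ℕ k → Σ ℕ λ j → N ≤ℕ j × Below k j
        below {k} N≤k with ¬∀⇒∃¬ (none k N≤k)
        ... | j , ¬[k<j→f≰] with ¬→⇒×¬ ¬[k<j→f≰]
        ...   | k<j , ¬¬fj≤fk = j , ≤-trans N≤k (<⇒≤ k<j) , k<j , ¬¬-elim ¬¬fj≤fk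
        chosen : Σ (ℕ → ℕ) λ s → (∀ n → N ≤ℕ s n) × (∀ n → Below (s n) (s (suc n)))
        chosen = Sequences.dependent-choice (N ≤ℕ_) Below (N , ≤ℕ-refl) below
        s : ℕ → ℕ
        s = proj₁ chosen
        -- Equality is excluded because f (s n) ≤ f (s (suc n)) would go up.
        strict-descent : ∀ n → f (s (suc n)) < f (s n)
        strict-descent n with proj₂ (proj₂ chosen) n
        ... | k<j , fj≤fk = fj≤fk , λ fj≡fk → bad k<j (reflexive (sym fj≡fk))

    no-bad-sequence : (f : ℕ → X) → ¬ Bad f
    no-bad-sequence f bad with ¬∀⇒∃¬ (terminals-bounded f bad)
    ... | N , no-terminal = terminals-unbounded f bad (N , λ k N≤k t → no-terminal (k , N≤k , t))

  -- Part (ii): on a wqo every closed set is a finite union of values of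
  -- the constructed γᵧ, which is the only nontrivial WADL axiom (L4).
  module Decomposition (em : ExcludedMiddle) (wqo : IsWQO) (Y : Subset X → Set₁)
                       (irreducible∈Y : ∀ F → Irreducible F → Y F) where
    open Construction Y
    open FiniteUnions γᵧ
    open Classical em
    open WellQuasiOrdered em wqo

    -- An irreducible F is one value of γᵧ: ↓x if F is principal, else F ∈ Lᵧ.
    generated-irreducible : ∀ F → Irreducible F → Generated F
    generated-irreducible F irr with decide (Σ X λ x → F ≐ ↓pt x)
    ... | yes (x , F⊆↓x , ↓x⊆F) = inj₂ x ∷ [] , (λ y → [ ↓x⊆F y , (λ ()) ]) , (λ y f → inj₁ (F⊆↓x y f))
    ... | no not-point = inj₁ (F , irreducible∈Y F irr , not-point) ∷ [] ,
                         (λ y → [ (λ f → f) , (λ ()) ]) , (λ y f → inj₁ f)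

    record Reduction (D : Subset X) : Set₁ where
      field
        F₁ F₂            : Subset X
        closed₁          : DownClosed F₁
        closed₂          : DownClosed F₂
        cover            : D ⊆ (F₁ ∪ F₂)
        ¬⊆₁              : ¬ (D ⊆ F₁)
        ¬⊆₂              : ¬ (D ⊆ F₂)

    -- An ungenerated closed set is reducible, since irreducible sets are generated.
    reducible : ∀ {D} → DownClosed D → ¬ Generated D → Reduction D
    reducible {D} D-closed ungenerated with em (Reduction D)
    ... | yes red = red
    ... | no ¬red = ⊥-elim (ungenerated (generated-irreducible D (D-closed , nonempty , prime)))
      where
      nonempty : ¬ (D ≐ ∅)
      nonempty (D⊆∅ , ∅⊆D) = ungenerated (generated-≐ generated-∅ (∅⊆D , D⊆∅))
      prime : ∀ F₁ F₂ → DownClosed F₁ → DownClosed F₂ → D ⊆ (F₁ ∪ F₂) → (D ⊆ F₁) ⊎ (D ⊆ F₂)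
      prime F₁ F₂ c₁ c₂ cover with decide (D ⊆ F₁) | decide (D ⊆ F₂)
      ... | yes D⊆F₁ | _        = inj₁ D⊆F₁
      ... | no _     | yes D⊆F₂ = inj₂ D⊆F₂
      ... | no ¬⊆₁   | no ¬⊆₂   = ⊥-elim (¬red (record
            { F₁ = F₁ ; F₂ = F₂ ; closed₁ = c₁ ; closed₂ = c₂ ; cover = cover ; ¬⊆₁ = ¬⊆₁ ; ¬⊆₂ = ¬⊆₂ }))

    Ungenerated : Subset X → Set₁
    Ungenerated D = DownClosed D × ¬ Generated D

    ProperSubset : Subset X → Subset X → Set
    ProperSubset D D′ = D′ ⊆ D × Σ X λ x → D x × ¬ D′ x

    ungenerated-piece : ∀ {D F} → DownClosed D → DownClosed F → ¬ (D ⊆ F) →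
      ¬ Generated (λ x → D x × F x) → Σ (Subset X) λ D′ → Ungenerated D′ × ProperSubset D D′
    ungenerated-piece {D} {F} D-closed F-closed D⊈F ungen with ⊈-witness D⊈F
    ... | x , d , ¬f = (λ y → D y × F y) , (∩-closed D-closed F-closed , ungen) ,
                       (λ y → proj₁) , x , d , (λ dx → ¬f (proj₂ dx))

    -- Since D = (D ∩ F₁) ∪ (D ∩ F₂), one of the two pieces is ungenerated,
    -- and it misses a point of D because D ⊈ Fᵢ.
    shrink : ∀ {D} → Ungenerated D → Σ (Subset X) λ D′ → Ungenerated D′ × ProperSubset D D′
    shrink {D} (D-closed , ungenerated) with reducible D-closed ungenerated
    ... | record { F₁ = F₁ ; F₂ = F₂ ; closed₁ = c₁ ; closed₂ = c₂ ; cover = cover ; ¬⊆₁ = ¬⊆₁ ; ¬⊆₂ = ¬⊆₂ }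
      with em (Generated (λ x → D x × F₁ x))
    ... | no  ungen₁ = ungenerated-piece D-closed c₁ ¬⊆₁ ungen₁
    ... | yes gen₁   = ungenerated-piece D-closed c₂ ¬⊆₂ λ gen₂ →
                         ungenerated (generated-≐ (generated-∪ gen₁ gen₂) pieces≐D)
      where
      pieces≐D : ((λ x → D x × F₁ x) ∪ (λ x → D x × F₂ x)) ≐ D
      pieces≐D = (λ x → [ proj₁ , proj₁ ]) ,
                 (λ x d → [ (λ f₁ → inj₁ (d , f₁)) , (λ f₂ → inj₂ (d , f₂)) ] (cover x d))

    -- An ungenerated set yields a strictly decreasing chain of ungenerated
    -- sets whose dropped points form a bad sequence; so there is none.
    all-generated : ∀ D → DownClosed D → Generated D
    all-generated D D-closed with em (Generated D)
    ... | yes gen       = gen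
    ... | no ungenerated = ⊥-elim (no-bad-sequence dropped dropped-bad)
      where
      chosen : Σ (ℕ → Subset X) λ Dₙ → (∀ n → Ungenerated (Dₙ n)) × (∀ n → ProperSubset (Dₙ n) (Dₙ (suc n)))
      chosen = Sequences.dependent-choice Ungenerated ProperSubset (D , D-closed , ungenerated) shrink
      Dₙ : ℕ → Subset X
      Dₙ = proj₁ chosen
      Dₙ-closed : ∀ n → DownClosed (Dₙ n)
      Dₙ-closed n = proj₁ (proj₁ (proj₂ chosen) n)
      proper : ∀ n → ProperSubset (Dₙ n) (Dₙ (suc n))
      proper = proj₂ (proj₂ chosen)
      dropped : ℕ → X
      dropped n = proj₁ (proj₂ (proper n))
      dropped∈ : ∀ n → Dₙ n (dropped n)
      dropped∈ n = proj₁ (proj₂ (proj₂ (proper n)))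
      dropped∉ : ∀ n → ¬ Dₙ (suc n) (dropped n)
      dropped∉ n = proj₂ (proj₂ (proj₂ (proper n)))
      decreasing : ∀ {i j} → i ≤ℕ j → Dₙ j ⊆ Dₙ i
      decreasing = Sequences.chain-≤ (λ A B → B ⊆ A) (λ x d → d) (λ A⊇B B⊇C x c → A⊇B x (B⊇C x c)) Dₙ
                     (λ n → proj₁ (proper n))
      -- xⱼ ∈ Dⱼ ⊆ Dᵢ₊₁, so xᵢ ≤ xⱼ would put xᵢ into the lower set Dᵢ₊₁.
      dropped-bad : Bad dropped
      dropped-bad {i} {j} i<j xᵢ≤xⱼ =
        dropped∉ i (closed⇒lower-set (Dₙ-closed (suc i)) xᵢ≤xⱼ (decreasing i<j _ (dropped∈ j)))

    construction-is-wadl : (∀ F → Y F → DownClosed F) → IsWADL Lᵧ _≼ᵧ_ γᵧ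
    construction-is-wadl Y-closed = record
      { L1-closed = λ { (inj₁ (F , F∈Y , _)) → Y-closed F F∈Y ; (inj₂ x) → ↓pt-closed x }
      ; L1-point  = λ x → (λ _ p → p) , (λ _ p → p)
      ; L3        = λ z z′ → mk⇔ (λ p → p) (λ p → p)
      ; L4        = all-generated
      }

proposition3p2 : {a b : Level} (X : Set) (_≤_ : X → X → Set) → IsPartialOrder _≡_ _≤_ →
    let open Order _≤_ in
    (∀ (L : Set a) (_≼_ : L ⊎ X → L ⊎ X → Set b) (γ : L ⊎ X → Subset X) →
    IsWADL L _≼_ γ →
    (∀ z z′ → (z ≼ z′) ⇔ (γ z ⊆ γ z′)) ×
    (∀ z → DownClosed (γ z)) ×
    (∀ F → Irreducible F → Σ (L ⊎ X) λ z → γ z ≐ F))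
    ×
    (ExcludedMiddle → IsWQO →
    ∀ (Y : Subset X → Set₁) →
    (∀ F → Y F → DownClosed F) →
    (∀ F → Irreducible F → Y F) →
    let open Construction Y in IsWADL Lᵧ _≼ᵧ_ γᵧ)
proposition3p2 X _≤_ isPO =
  (λ L _≼_ γ wadl → IsWADL.L3 wadl , IsWADL.L1-closed wadl , wadl-covers-irreducibles wadl) ,
  (λ em wqo Y Y-closed irreducible∈Y → Decomposition.construction-is-wadl em wqo Y irreducible∈Y Y-closed)
  where
  open Order _≤_ using (module IsWADL)
  open Poset X _≤_ isPO
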